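{- Let $n \ge k \ge 3$ be integers. Then $(C_n,k)$ is niche-realizable if and only if $(n,k)\in\{(5,3),(5,4),(5,5),(6,3)\}$.
   Context: $C_n$ is the cycle on $n$ vertices. A $k$-partite tournament is an orientation of a complete $k$-partite graph with $k$ nonempty partite sets. The niche graph $\mathcal{N}(D)$ of a digraph $D$ has vertex set $V(D)$, and two distinct vertices are adjacent iff they have a common out-neighbor in $D$ or a common in-neighbor in $D$. The pair $(G,k)$ is niche-realizable if $G$ is isomorphic to the niche graph of some $k$-partite tournament. -}

module Defs where

open import Level using (0ℓ)
open import Data.Nat using (ℕ; zero; suc)
open import Data.Fin using (Fin; toℕ)
open import Data.Product using (Σ; ∃; _×_)
open import Data.Sum using (_⊎_)
open import Relation.Nullary using (¬_)
open import Relation.Binary.PropositionalEquality using (_≡_; _≢_)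
open import Function.Bundles using (_↔_; _⇔_; Inverse)

-- A (simple, loopless) graph / digraph on vertex set Fin m is given by a
-- binary relation on Fin m.
Rel : ℕ → Set₁
Rel m = Fin m → Fin m → Set

CycleStep : (n : ℕ) → Rel n
CycleStep n i j = (suc (toℕ i) ≡ toℕ j) ⊎ (suc (toℕ i) ≡ n × toℕ j ≡ 0)

Cycle : (n : ℕ) → Rel n
Cycle n i j = CycleStep n i j ⊎ CycleStep n j i

record IsMultipartiteTournament {m : ℕ} (k : ℕ) (D : Rel m) (p : Fin m → Fin k) : Set where
  field
    parts-nonempty : ∀ (c : Fin k) → ∃ λ v → p v ≡ c
    no-arc-within  : ∀ u v → p u ≡ p v → ¬ D u v
    orientation    : ∀ u v → p u ≢ p v → (D u v × ¬ D v u) ⊎ (D v u × ¬ D u v)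

Niche : {m : ℕ} → Rel m → Rel m
Niche D u v = u ≢ v × ((∃ λ w → D u w × D v w) ⊎ (∃ λ w → D w u × D w v))

Isomorphic : {n m : ℕ} → Rel n → Rel m → Set
Isomorphic {n} {m} G H =
  Σ (Fin n ↔ Fin m) λ f → ∀ i j → G i j ⇔ H (Inverse.to f i) (Inverse.to f j)

NicheRealizable : {n : ℕ} → Rel n → ℕ → Set₁
NicheRealizable {n} G k =
  Σ ℕ λ m → Σ (Rel m) λ D → Σ (Fin m → Fin k) λ p →
    IsMultipartiteTournament k D p × Isomorphic G (Niche D)

-- If n ≥ 4 then C_n, and hence the niche graph of D, is triangle-free.  Three out-neighbours
-- (or in-neighbours) of one vertex would span a triangle, so each vertex of D has at most two
-- of each and meets at most four vertices outside its own part.  Every vertex lies outside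
-- k - 1 of the k parts, so double counting against one representative per part gives
-- n (k - 1) ≤ 4k, which for 5 ≤ n and k ≤ n leaves exactly (5,3), (5,4), (5,5) and (6,3).
-- The cycles C_3 and C_4 are ruled out by exhaustive search over oriented graphs, and the four
-- exceptional pairs are realized by letting every vertex of ℤ_n point to the one or two
-- vertices just before it, except within a part.

module Submission where

open import Defs
open import Data.Bool using (Bool; true; false; T; if_then_else_)
open import Data.Bool.Properties using (T?)
open import Data.Empty using (⊥)
open import Data.Unit using (⊤; tt)
open import Data.Fin using (Fin; zero; suc; toℕ; #_)
open import Data.Fin.Properties using (_≟_; any?; all?; toℕ<n; suc-injective)
open import Data.Nat using (ℕ; zero; suc; pred; _+_; _*_; _%_; _≤_; _<_; z≤n; s≤s; NonZero)
open import Data.Nat.Properties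
  using (≤-refl; ≤-reflexive; ≤-trans; ≤-antisym; ≤-pred; <⇒≱; n≮n; m≤m+n; m≤n+m; n≤1+n;
         m≤n⇒m≤1+n; m≤n⇒m<n∨m≡n; m≢1+n+m; +-mono-≤; *-monoˡ-≤; *-cancelˡ-≤; *-cancelʳ-≤;
         *-cancelʳ-<; *-identityʳ; +-0-commutativeMonoid; module ≤-Reasoning)
  renaming (_≟_ to _≟ℕ_)
open import Algebra.Properties.CommutativeMonoid.Sum +-0-commutativeMonoid
  using (sum; sum-syntax; sum-cong-≗; ∑-distrib-+; ∑-comm)
open import Data.Product using (Σ; ∃; _×_; _,_; proj₁; proj₂; uncurry)
open import Data.Sum using (_⊎_; inj₁; inj₂)
open import Data.Vec using (Vec; []; _∷_; lookup; tabulate)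
open import Data.Vec.Properties using (lookup∘tabulate)
open import Function using (_∘_)
open import Function.Bundles using (_⇔_; mk⇔; Equivalence; _↔_; Inverse; Injection)
open import Function.Properties.Inverse using (↔⇒↣)
open import Function.Construct.Composition using (_⇔-∘_)
open import Function.Construct.Identity using (↔-id)
open import Function.Construct.Symmetry using (⇔-sym)
open import Relation.Binary using (Decidable)
open import Relation.Binary.PropositionalEquality using (_≡_; _≢_; refl; sym; trans; cong; subst)
open import Relation.Nullary using (Dec; yes; no; ¬_; ¬?; contradiction; does)
open import Relation.Nullary.Decidable using (_×-dec_; _⊎-dec_; _→-dec_; map′; from-yes; True; toWitness)
import Relation.Unary as U

_⇔-dec_ : ∀ {A B : Set} → Dec A → Dec B → Dec (A ⇔ B)
a? ⇔-dec b? = map′ (λ (f , g) → mk⇔ f g) (λ e → Equivalence.to e , Equivalence.from e)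
  ((a? →-dec b?) ×-dec (b? →-dec a?))

cycle? : ∀ n → Decidable (Cycle n)
cycle? n i j = step? i j ⊎-dec step? j i
  where
  step? : Decidable (CycleStep n)
  step? i j = (suc (toℕ i) ≟ℕ toℕ j) ⊎-dec ((suc (toℕ i) ≟ℕ n) ×-dec (toℕ j ≟ℕ 0))

niche? : ∀ {m} {D : Rel m} → Decidable D → Decidable (Niche D)
niche? D? u v = ¬? (u ≟ v) ×-dec
  (any? (λ w → D? u w ×-dec D? v w) ⊎-dec any? (λ w → D? w u ×-dec D? w v))

isMultipartiteTournament? : ∀ {m k} {D : Rel m} → Decidable D → (p : Fin m → Fin k) →
  Dec (IsMultipartiteTournament k D p)
isMultipartiteTournament? D? p =
  map′ (λ (ne , nw , or) → record { parts-nonempty = ne ; no-arc-within = nw ; orientation = or })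
       (λ mt → let open IsMultipartiteTournament mt in parts-nonempty , no-arc-within , orientation)
       (all? (λ c → any? (λ v → p v ≟ c)) ×-dec
        all? (λ u → all? (λ v → (p u ≟ p v) →-dec ¬? (D? u v))) ×-dec
        all? (λ u → all? (λ v → ¬? (p u ≟ p v) →-dec
          ((D? u v ×-dec ¬? (D? v u)) ⊎-dec (D? v u ×-dec ¬? (D? u v))))))

niche-⇔ : ∀ {n} {D E : Rel n} → (∀ u v → D u v ⇔ E u v) → ∀ u v → Niche D u v ⇔ Niche E u v
niche-⇔ D⇔E u v = mk⇔ (transport D⇔E) (transport (λ x y → ⇔-sym (D⇔E x y)))
  where
  open Equivalence
  transport : ∀ {D E : Rel _} → (∀ u v → D u v ⇔ E u v) → Niche D u v → Niche E u v
  transport D⇔E (u≢v , inj₁ (w , uw , vw)) = u≢v , inj₁ (w , to (D⇔E u w) uw , to (D⇔E v w) vw)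
  transport D⇔E (u≢v , inj₂ (w , wu , wv)) = u≢v , inj₂ (w , to (D⇔E w u) wu , to (D⇔E w v) wv)

NicheRealization : ∀ {n} → Rel n → ℕ → Set₁
NicheRealization {n} G k =
  Σ (Rel n) λ D → Σ (Fin n → Fin k) λ p →
    IsMultipartiteTournament k D p × (∀ i j → G i j ⇔ Niche D i j)

realization⇒realizable : ∀ {n} {G : Rel n} {k} → NicheRealization G k → NicheRealizable G k
realization⇒realizable {n} (D , p , mt , iso) = n , D , p , mt , ↔-id (Fin n) , iso

module _ {n m} (F : Fin n ↔ Fin m) where
  open Inverse F
  open Injection (↔⇒↣ F) using (injective)

  niche-relabel : ∀ (D : Rel m) i j → Niche (λ u v → D (to u) (to v)) i j ⇔ Niche D (to i) (to j)
  niche-relabel D i j = mk⇔ forth back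
    where
    forth : Niche (λ u v → D (to u) (to v)) i j → Niche D (to i) (to j)
    forth (i≢j , inj₁ (w , both)) = i≢j ∘ injective , inj₁ (to w , both)
    forth (i≢j , inj₂ (w , both)) = i≢j ∘ injective , inj₂ (to w , both)
    back : Niche D (to i) (to j) → Niche (λ u v → D (to u) (to v)) i j
    back (ti≢tj , inj₁ (w , both)) = ti≢tj ∘ cong to ,
      inj₁ (from w , subst (λ x → D (to i) x × D (to j) x) (sym (strictlyInverseˡ w)) both)
    back (ti≢tj , inj₂ (w , both)) = ti≢tj ∘ cong to ,
      inj₂ (from w , subst (λ x → D x (to i) × D x (to j)) (sym (strictlyInverseˡ w)) both)

  isMultipartiteTournament-relabel : ∀ {k} {D : Rel m} {p : Fin m → Fin k} →
    IsMultipartiteTournament k D p → IsMultipartiteTournament k (λ u v → D (to u) (to v)) (p ∘ to)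
  isMultipartiteTournament-relabel {p = p} mt = record
    { parts-nonempty = λ c → let (v , pv≡c) = parts-nonempty c in
                               from v , trans (cong p (strictlyInverseˡ v)) pv≡c
    ; no-arc-within  = λ u v → no-arc-within (to u) (to v)
    ; orientation    = λ u v → orientation (to u) (to v)
    }
    where open IsMultipartiteTournament mt

realizable⇒realization : ∀ {n} {G : Rel n} {k} → NicheRealizable G k → NicheRealization G k
realizable⇒realization (m , D , p , mt , F , iso) =
  (λ u v → D (to u) (to v)) , p ∘ to , isMultipartiteTournament-relabel F mt ,
  λ i j → ⇔-sym (niche-relabel F D i j) ⇔-∘ iso i j
  where open Inverse F

𝟙 : ∀ {A : Set} → Dec A → ℕ
𝟙 a? = if does a? then 1 else 0

1≤𝟙 : ∀ {A : Set} (a? : Dec A) → A → 1 ≤ 𝟙 a?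
1≤𝟙 (yes _) _ = ≤-refl
1≤𝟙 (no ¬a) a = contradiction a ¬a

count : ∀ {n} {P : Fin n → Set} → U.Decidable P → ℕ
count {n} P? = ∑[ i < n ] 𝟙 (P? i)

∑-const : ∀ n c → ∑[ i < n ] c ≡ n * c
∑-const zero    c = refl
∑-const (suc n) c = cong (c +_) (∑-const n c)

∑-mono-≤ : ∀ {n} {f g : Fin n → ℕ} → (∀ i → f i ≤ g i) → sum f ≤ sum g
∑-mono-≤ {zero}  f≤g = z≤n
∑-mono-≤ {suc n} f≤g = +-mono-≤ (f≤g zero) (∑-mono-≤ (f≤g ∘ suc))

count≡0 : ∀ {n} {P : Fin n → Set} (P? : U.Decidable P) → (∀ x → ¬ P x) → count P? ≡ 0
count≡0 {zero}  P? ¬P = refl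
count≡0 {suc n} P? ¬P with P? zero
... | yes P0 = contradiction P0 (¬P zero)
... | no  _  = count≡0 (P? ∘ suc) (¬P ∘ suc)

count≤1 : ∀ {n} {P : Fin n → Set} (P? : U.Decidable P) →
  (∀ x y → x ≢ y → P x → P y → ⊥) → count P? ≤ 1
count≤1 {zero}  P? at-most-one = z≤n
count≤1 {suc n} P? at-most-one with P? zero
... | yes P0 = s≤s (≤-reflexive (count≡0 (P? ∘ suc) (λ x → at-most-one zero (suc x) (λ ()) P0)))
... | no  _  = count≤1 (P? ∘ suc) (λ x y x≢y → at-most-one (suc x) (suc y) (x≢y ∘ suc-injective))

count≤2 : ∀ {n} {P : Fin n → Set} (P? : U.Decidable P) →
  (∀ x y z → x ≢ y → x ≢ z → y ≢ z → P x → P y → P z → ⊥) → count P? ≤ 2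
count≤2 {zero}  P? at-most-two = z≤n
count≤2 {suc n} P? at-most-two with P? zero
... | yes P0 = s≤s (count≤1 (P? ∘ suc) λ x y x≢y →
  at-most-two zero (suc x) (suc y) (λ ()) (λ ()) (x≢y ∘ suc-injective) P0)
... | no  _  = count≤2 (P? ∘ suc) (λ x y z x≢y x≢z y≢z →
  at-most-two (suc x) (suc y) (suc z) (x≢y ∘ suc-injective) (x≢z ∘ suc-injective) (y≢z ∘ suc-injective))

count-≢ : ∀ {k} (c : Fin k) → count (λ j → ¬? (j ≟ c)) ≡ pred k
count-≢ {suc k}       zero    = trans (∑-const k 1) (*-identityʳ k)
count-≢ {suc (suc k)} (suc c) = cong suc (count-≢ c)

Oriented : ∀ {n} → Rel n → Set
Oriented D = ∀ u v → D u v → ¬ D v u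

TriangleFree : ∀ {n} → Rel n → Set
TriangleFree G = ∀ x y z → G x y → G y z → G x z → ⊥

triangleFree-⇔ : ∀ {n} {G H : Rel n} → (∀ i j → G i j ⇔ H i j) → TriangleFree G → TriangleFree H
triangleFree-⇔ G⇔H G-free x y z xy yz xz =
  G-free x y z (from (G⇔H x y) xy) (from (G⇔H y z) yz) (from (G⇔H x z) xz)
  where open Equivalence

module MultipartiteTournament {m k} {D : Rel m} {p : Fin m → Fin k}
                              (mt : IsMultipartiteTournament k D p) where
  open IsMultipartiteTournament mt

  arc? : Decidable D
  arc? u v with p u ≟ p v
  ... | yes same = no (no-arc-within u v same)
  ... | no  diff with orientation u v diff
  ...   | inj₁ (uv , _)  = yes uv
  ...   | inj₂ (_ , ¬uv) = no ¬uv

  oriented : Oriented D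
  oriented u v uv vu with orientation u v (λ same → no-arc-within u v same uv)
  ... | inj₁ (_ , ¬vu) = ¬vu vu
  ... | inj₂ (_ , ¬uv) = ¬uv uv

  module _ (triangle-free : TriangleFree (Niche D)) where

    out-degree≤2 : ∀ a → count (arc? a) ≤ 2
    out-degree≤2 a = count≤2 (arc? a) λ x y z x≢y x≢z y≢z ax ay az →
      triangle-free x y z (x≢y , inj₂ (a , ax , ay)) (y≢z , inj₂ (a , ay , az)) (x≢z , inj₂ (a , ax , az))

    in-degree≤2 : ∀ a → count (λ x → arc? x a) ≤ 2
    in-degree≤2 a = count≤2 (λ x → arc? x a) λ x y z x≢y x≢z y≢z xa ya za →
      triangle-free x y z (x≢y , inj₁ (a , xa , ya)) (y≢z , inj₁ (a , ya , za)) (x≢z , inj₁ (a , xa , za))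

    other-parts≤4 : ∀ a → count (λ x → ¬? (p a ≟ p x)) ≤ 4
    other-parts≤4 a = begin
      count (λ x → ¬? (p a ≟ p x))                 ≤⟨ ∑-mono-≤ other-part⇒arc ⟩
      ∑[ x < m ] (𝟙 (arc? a x) + 𝟙 (arc? x a))     ≡⟨ ∑-distrib-+ (𝟙 ∘ arc? a) (λ x → 𝟙 (arc? x a)) ⟩
      count (arc? a) + count (λ x → arc? x a)      ≤⟨ +-mono-≤ (out-degree≤2 a) (in-degree≤2 a) ⟩
      4                                            ∎
      where
      open ≤-Reasoning
      other-part⇒arc : ∀ x → 𝟙 (¬? (p a ≟ p x)) ≤ 𝟙 (arc? a x) + 𝟙 (arc? x a)
      other-part⇒arc x = apart⇒arc (p a ≟ p x)
        where
        apart⇒arc : (same? : Dec (p a ≡ p x)) → 𝟙 (¬? same?) ≤ 𝟙 (arc? a x) + 𝟙 (arc? x a)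
        apart⇒arc (yes _)    = z≤n
        apart⇒arc (no  diff) with orientation a x diff
        ... | inj₁ (ax , _) = ≤-trans (1≤𝟙 (arc? a x) ax) (m≤m+n _ _)
        ... | inj₂ (xa , _) = ≤-trans (1≤𝟙 (arc? x a) xa) (m≤n+m _ _)

    order-bound : m * pred k ≤ k * 4
    order-bound = begin
      m * pred k                                          ≡⟨ ∑-const m (pred k) ⟨
      ∑[ x < m ] pred k                                   ≡⟨ sum-cong-≗ (λ x → sym (other-parts x)) ⟩
      ∑[ x < m ] ∑[ c < k ] 𝟙 (¬? (p (rep c) ≟ p x))      ≡⟨ ∑-comm (λ x c → 𝟙 (¬? (p (rep c) ≟ p x))) ⟩
      ∑[ c < k ] ∑[ x < m ] 𝟙 (¬? (p (rep c) ≟ p x))      ≤⟨ ∑-mono-≤ (other-parts≤4 ∘ rep) ⟩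
      ∑[ c < k ] 4                                        ≡⟨ ∑-const k 4 ⟩
      k * 4                                               ∎
      where
      open ≤-Reasoning
      rep : Fin k → Fin m
      rep c = proj₁ (parts-nonempty c)
      other-parts : ∀ x → count (λ c → ¬? (p (rep c) ≟ p x)) ≡ pred k
      other-parts x =
        trans (sum-cong-≗ λ c → cong (λ c′ → 𝟙 (¬? (c′ ≟ p x))) (proj₂ (parts-nonempty c))) (count-≢ (p x))

prev : ℕ → ℕ → ℕ
prev n zero    = pred n
prev n (suc a) = a

Linked : ℕ → ℕ → ℕ → Set
Linked n a b = a ≡ prev n b ⊎ b ≡ prev n a

step⇒prev : ∀ {n a b} → (suc a ≡ b) ⊎ (suc a ≡ n × b ≡ 0) → a ≡ prev n b
step⇒prev (inj₁ refl)         = refl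
step⇒prev (inj₂ (refl , refl)) = refl

cycle⇒linked : ∀ {n} {i j : Fin n} → Cycle n i j → Linked n (toℕ i) (toℕ j)
cycle⇒linked (inj₁ i→j) = inj₁ (step⇒prev i→j)
cycle⇒linked (inj₂ j→i) = inj₂ (step⇒prev j→i)

prev-injective : ∀ {n a b} → a < n → b < n → prev n a ≡ prev n b → a ≡ b
prev-injective {a = zero}  {zero}  _ _ _ = refl
prev-injective {a = suc a} {suc b} _ _ e = cong suc e
prev-injective {suc n} {zero}  {suc b} _ (s≤s b<n) e = contradiction (subst (suc b ≤_) e b<n) (n≮n b)
prev-injective {suc n} {suc a} {zero}  (s≤s a<n) _ e = contradiction (subst (suc a ≤_) (sym e) a<n) (n≮n a)

prev-fixpoint-free : ∀ {n a} → 2 ≤ n → prev n a ≢ a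
prev-fixpoint-free {a = zero}  (s≤s (s≤s _)) ()
prev-fixpoint-free {a = suc a} _             = m≢1+n+m a {0}

prev³-fixpoint-free : ∀ {n a} → 4 ≤ n → prev n (prev n (prev n a)) ≢ a
prev³-fixpoint-free {a = 0}                 (s≤s (s≤s (s≤s (s≤s _)))) ()
prev³-fixpoint-free {a = 1}                 (s≤s (s≤s (s≤s (s≤s _)))) ()
prev³-fixpoint-free {a = 2}                 (s≤s (s≤s (s≤s (s≤s _)))) ()
prev³-fixpoint-free {a = suc (suc (suc a))} _                            = m≢1+n+m a {2}

-- prev is injective, so a triangle of links either collapses onto a fixed point of prev
-- or closes up to a fixed point of prev³.
linked-triangle-free : ∀ {n a b c} → 4 ≤ n → a < n → b < n → c < n →
  Linked n a b → Linked n b c → Linked n a c → ⊥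
linked-triangle-free {n} 4≤n = triangle
  where
  unmoved : ∀ {a} → prev n a ≢ a
  unmoved = prev-fixpoint-free (≤-trans (s≤s (s≤s z≤n)) 4≤n)
  triangle : ∀ {a b c} → a < n → b < n → c < n → Linked n a b → Linked n b c → Linked n a c → ⊥
  triangle _  b< c< (inj₁ refl) (inj₁ refl) (inj₁ e)   = unmoved (prev-injective b< c< e)
  triangle _  _  _  (inj₁ refl) (inj₁ refl) (inj₂ e)   = prev³-fixpoint-free 4≤n (sym e)
  triangle _  b< c< (inj₁ refl) (inj₂ refl) (inj₁ e)   = unmoved (sym (prev-injective b< c< e))
  triangle _  b< c< (inj₁ refl) (inj₂ refl) (inj₂ e)   = unmoved (sym (prev-injective b< c< e))
  triangle a< _  c< (inj₂ refl) (inj₁ e)   (inj₁ refl) = unmoved (prev-injective a< c< e)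
  triangle a< _  c< (inj₂ refl) (inj₁ e)   (inj₂ refl) = unmoved (sym (prev-injective a< c< e))
  triangle _  _  _  (inj₂ refl) (inj₂ refl) (inj₁ e)   = prev³-fixpoint-free 4≤n (sym e)
  triangle a< b< _  (inj₂ refl) (inj₂ refl) (inj₂ e)   = unmoved (prev-injective b< a< e)

cycle-triangle-free : ∀ {n} → 4 ≤ n → TriangleFree (Cycle n)
cycle-triangle-free h x y z xy yz xz =
  linked-triangle-free h (toℕ<n x) (toℕ<n y) (toℕ<n z) (cycle⇒linked xy) (cycle⇒linked yz) (cycle⇒linked xz)

-- Exhaustive search over oriented graphs

Searchable : Set → Set₁
Searchable A = ∀ {P : A → Set} → U.Decidable P → Dec (∀ a → P a)

⊤-searchable : Searchable ⊤
⊤-searchable P? = map′ (λ P → λ { tt → P }) (λ P → P tt) (P? tt)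

×-searchable : ∀ {A B} → Searchable A → Searchable B → Searchable (A × B)
×-searchable search-A search-B P? = map′ (λ P → λ { (a , b) → P a b }) (λ P a b → P (a , b))
  (search-A λ a → search-B λ b → P? (a , b))

Vec-searchable : ∀ {A} → Searchable A → ∀ n → Searchable (Vec A n)
Vec-searchable search zero    P? = map′ (λ P[] → λ { [] → P[] }) (λ P → P []) (P? [])
Vec-searchable search (suc n) P? = map′ (λ P → λ { (a ∷ v) → P a v }) (λ P a v → P (a ∷ v))
  (search λ a → Vec-searchable search n (P? ∘ (a ∷_)))

data Orientation : Set where
  forward backward absent : Orientation

Orientation-searchable : Searchable Orientation
Orientation-searchable P? =
  map′ (λ (Pf , Pb , Pa) → λ { forward → Pf ; backward → Pb ; absent → Pa })
       (λ P → P forward , P backward , P absent)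
       (P? forward ×-dec P? backward ×-dec P? absent)

isForward isBackward : Orientation → Bool
isForward forward   = true
isForward _         = false
isBackward backward = true
isBackward _        = false

-- An oriented graph on Fin n, stored as the orientations of the pairs (u, v) with u < v.
UpperTriangle : ℕ → Set
UpperTriangle zero    = ⊤
UpperTriangle (suc n) = Vec Orientation n × UpperTriangle n

UpperTriangle-searchable : ∀ n → Searchable (UpperTriangle n)
UpperTriangle-searchable zero    = ⊤-searchable
UpperTriangle-searchable (suc n) =
  ×-searchable (Vec-searchable Orientation-searchable n) (UpperTriangle-searchable n)

arc : ∀ {n} → UpperTriangle n → Fin n → Fin n → Bool
arc (_ , _) zero    zero    = false
arc (r , _) zero    (suc v) = isForward (lookup r v)
arc (r , _) (suc u) zero    = isBackward (lookup r u)
arc (_ , t) (suc u) (suc v) = arc t u v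

arcs : ∀ {n} → UpperTriangle n → Rel n
arcs t u v = T (arc t u v)

pairOrientation : ∀ {A B : Set} → Dec A → Dec B → Orientation
pairOrientation (yes _) _       = forward
pairOrientation (no _)  (yes _) = backward
pairOrientation (no _)  (no _)  = absent

upperTriangle : ∀ {n} {D : Rel n} → Decidable D → UpperTriangle n
upperTriangle {zero}  D? = tt
upperTriangle {suc n} D? =
  tabulate (λ v → pairOrientation (D? zero (suc v)) (D? (suc v) zero)) , upperTriangle (λ u v → D? (suc u) (suc v))

arcs-upperTriangle : ∀ {n} {D : Rel n} (D? : Decidable D) → Oriented D →
  ∀ u v → arcs (upperTriangle D?) u v ⇔ D u v
arcs-upperTriangle {suc n} D? oriented zero zero = mk⇔ (λ ()) (λ d → oriented zero zero d d)
arcs-upperTriangle {suc n} D? oriented zero (suc v)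
  rewrite lookup∘tabulate (λ v → pairOrientation (D? zero (suc v)) (D? (suc v) zero)) v
  with D? zero (suc v) | D? (suc v) zero
... | yes d | _     = mk⇔ (λ _ → d) _
... | no ¬d | yes _ = mk⇔ (λ ()) ¬d
... | no ¬d | no _  = mk⇔ (λ ()) ¬d
arcs-upperTriangle {suc n} D? oriented (suc u) zero
  rewrite lookup∘tabulate (λ v → pairOrientation (D? zero (suc v)) (D? (suc v) zero)) u
  with D? zero (suc u) | D? (suc u) zero
... | yes d | _     = mk⇔ (λ ()) (oriented zero (suc u) d)
... | no _  | yes d = mk⇔ (λ _ → d) _
... | no _  | no ¬d = mk⇔ (λ ()) ¬d
arcs-upperTriangle {suc n} D? oriented (suc u) (suc v) =
  arcs-upperTriangle (λ u v → D? (suc u) (suc v)) (λ u v → oriented (suc u) (suc v)) u v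

NicheGraphOf : ∀ {n} → Rel n → UpperTriangle n → Set
NicheGraphOf G t = ∀ i j → G i j ⇔ Niche (arcs t) i j

realization⇒upperTriangle : ∀ {n} {G : Rel n} {k} → NicheRealization G k → ∃ (NicheGraphOf G)
realization⇒upperTriangle (D , p , mt , G⇔niche) =
  upperTriangle arc? , λ i j → ⇔-sym (niche-⇔ (arcs-upperTriangle arc? oriented) i j) ⇔-∘ G⇔niche i j
  where open MultipartiteTournament mt

nicheGraphOf-none? : ∀ {n} {G : Rel n} → Decidable G → Dec (∀ t → ¬ NicheGraphOf G t)
nicheGraphOf-none? {n} G? = UpperTriangle-searchable n λ t →
  ¬? (all? λ i → all? λ j → G? i j ⇔-dec niche? (λ u v → T? (arc t u v)) i j)

cycle-unrealizable-on-3-or-4 : ∀ {n k} → n ≡ 3 ⊎ n ≡ 4 → ¬ NicheRealization (Cycle n) k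
cycle-unrealizable-on-3-or-4 {n} n≡3⊎n≡4 = uncurry (no-upperTriangle n≡3⊎n≡4) ∘ realization⇒upperTriangle
  where
  no-upperTriangle : n ≡ 3 ⊎ n ≡ 4 → ∀ t → ¬ NicheGraphOf (Cycle n) t
  no-upperTriangle (inj₁ refl) = from-yes (nicheGraphOf-none? (cycle? 3))
  no-upperTriangle (inj₂ refl) = from-yes (nicheGraphOf-none? (cycle? 4))

Exceptional : ℕ → ℕ → Set
Exceptional n k = (n ≡ 5 × k ≡ 3) ⊎ (n ≡ 5 × k ≡ 4) ⊎ (n ≡ 5 × k ≡ 5) ⊎ (n ≡ 6 × k ≡ 3)

Circulant : ∀ n .{{_ : NonZero n}} {k} → (Fin n → Fin k) → Rel n
Circulant n p u v = p u ≢ p v × (toℕ u ≡ (1 + toℕ v) % n ⊎ toℕ u ≡ (2 + toℕ v) % n)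

circulant? : ∀ n .{{_ : NonZero n}} {k} (p : Fin n → Fin k) → Decidable (Circulant n p)
circulant? n p u v =
  ¬? (p u ≟ p v) ×-dec ((toℕ u ≟ℕ (1 + toℕ v) % n) ⊎-dec (toℕ u ≟ℕ (2 + toℕ v) % n))

circulant-realization : ∀ {n k} .{{_ : NonZero n}} (p : Fin n → Fin k) →
  {_ : True (isMultipartiteTournament? (circulant? n p) p)} →
  {_ : True (all? λ i → all? λ j → cycle? n i j ⇔-dec niche? (circulant? n p) i j)} →
  NicheRealization (Cycle n) k
circulant-realization {n} p {mt} {cycle⇔niche} = Circulant n p , p , toWitness mt , toWitness cycle⇔niche

exceptional-realization : ∀ {n k} → Exceptional n k → NicheRealization (Cycle n) k
exceptional-realization (inj₁ (refl , refl)) =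
  circulant-realization (lookup (# 0 ∷ # 0 ∷ # 0 ∷ # 1 ∷ # 2 ∷ []))
exceptional-realization (inj₂ (inj₁ (refl , refl))) =
  circulant-realization (lookup (# 0 ∷ # 0 ∷ # 1 ∷ # 2 ∷ # 3 ∷ []))
exceptional-realization (inj₂ (inj₂ (inj₁ (refl , refl)))) =
  circulant-realization (λ u → u)
exceptional-realization (inj₂ (inj₂ (inj₂ (refl , refl)))) =
  circulant-realization (lookup (# 0 ∷ # 1 ∷ # 2 ∷ # 0 ∷ # 1 ∷ # 2 ∷ []))

parts≤5 : ∀ {n k} → k ≤ n → n * pred k ≤ k * 4 → k ≤ 5
parts≤5 {n} {zero}  _   _     = z≤n
parts≤5 {n} {suc k} k≤n bound = s≤s (*-cancelˡ-≤ (suc k) (≤-trans (*-monoˡ-≤ k k≤n) bound))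

five-or-six : ∀ {n} → 5 ≤ n → n ≤ 6 → n ≡ 5 ⊎ n ≡ 6
five-or-six 5≤n n≤6 with m≤n⇒m<n∨m≡n 5≤n
... | inj₁ 5<n = inj₂ (≤-antisym n≤6 5<n)
... | inj₂ 5≡n = inj₁ (sym 5≡n)

exceptional-order : ∀ {n k} → 3 ≤ k → k ≤ n → 5 ≤ n → n * pred k ≤ k * 4 → Exceptional n k
exceptional-order {k = 1} (s≤s ())        _ _ _
exceptional-order {k = 2} (s≤s (s≤s ())) _ _ _
exceptional-order {n} {3} _ _ 5≤n bound with five-or-six 5≤n (*-cancelʳ-≤ n 6 2 bound)
... | inj₁ n≡5 = inj₁ (n≡5 , refl)
... | inj₂ n≡6 = inj₂ (inj₂ (inj₂ (n≡6 , refl)))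
exceptional-order {n} {4} _ _ 5≤n bound =
  inj₂ (inj₁ (≤-antisym (≤-pred (*-cancelʳ-< 3 n 6 (s≤s (m≤n⇒m≤1+n bound)))) 5≤n , refl))
exceptional-order {n} {5} _ _ 5≤n bound =
  inj₂ (inj₂ (inj₁ (≤-antisym (*-cancelʳ-≤ n 5 4 bound) 5≤n , refl)))
exceptional-order {k = suc (suc (suc (suc (suc (suc k)))))} _ k≤n _ bound =
  contradiction (parts≤5 k≤n bound) (<⇒≱ (m≤m+n 6 k))

three-four-or-more : ∀ {n} → 3 ≤ n → (n ≡ 3 ⊎ n ≡ 4) ⊎ 5 ≤ n
three-four-or-more 3≤n with m≤n⇒m<n∨m≡n 3≤n
... | inj₂ 3≡n = inj₁ (inj₁ (sym 3≡n))
... | inj₁ 4≤n with m≤n⇒m<n∨m≡n 4≤n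
...   | inj₂ 4≡n = inj₁ (inj₂ (sym 4≡n))
...   | inj₁ 5≤n = inj₂ 5≤n

lemma4p9 : ∀ (n k : ℕ) → 3 ≤ k → k ≤ n →
    (NicheRealizable (Cycle n) k ⇔
      ((n ≡ 5 × k ≡ 3) ⊎ (n ≡ 5 × k ≡ 4) ⊎ (n ≡ 5 × k ≡ 5) ⊎ (n ≡ 6 × k ≡ 3)))
lemma4p9 n k 3≤k k≤n =
  mk⇔ (classify ∘ realizable⇒realization) (realization⇒realizable ∘ exceptional-realization)
  where
  classify : NicheRealization (Cycle n) k → Exceptional n k
  classify R@(_ , _ , mt , cycle⇔niche) with three-four-or-more (≤-trans 3≤k k≤n)
  ... | inj₁ n≡3⊎n≡4 = contradiction R (cycle-unrealizable-on-3-or-4 n≡3⊎n≡4)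
  ... | inj₂ 5≤n     = exceptional-order 3≤k k≤n 5≤n (MultipartiteTournament.order-bound mt
    (triangleFree-⇔ cycle⇔niche (cycle-triangle-free (≤-trans (n≤1+n 4) 5≤n))))
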